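{- Let $\delta^*$ be a minimal feasible integral solution of the covering formulation [COV], with set of basic triples $T$. For $v\in V$ let $S_v=\{(i,j):(v,i,j)\in T\}$, $M_v=\{(i,j):(j,v,i)\in T\}$ and $E_v=\{(i,j):(i,j,v)\in T\}$. Then for every $v\in V$ and every $X\in\{S_v,E_v\}$, the solution $\delta^X$ defined by (1) $\delta^X_{(i,j)}=0$ for each $(i,j)\in M_v$; (2) $\delta^X_{(i,j)}=0$ and $\delta^X_{(j,i)}=1$ for each $(i,j)\in X$; (3) $\delta^X_{(i,j)}=\delta^*_{(i,j)}$ for all other pairs, is a feasible solution of [COV].
   Context: $V$ is a finite set and $P$ a partial order on $V$ (reflexive, antisymmetric, transitive, viewed as a set of ordered pairs, so $(x,x)\in P$ for all $x$). $\mathrm{inc}(P)=\{(x,y)\in V\times V:(x,y)\notin P,\ (y,x)\notin P\}$. A solution is a vector $\delta=(\delta_{(i,j)})$ indexed by ordered pairs of distinct elements of $V$, where only entries on pairs of $\mathrm{inc}(P)$ are free; by convention, for $i\neq j$, $\delta_{(i,j)}=1$ if $(i,j)\in P$ and $\delta_{(i,j)}=0$ if $(j,i)\in P$. Covering formulation [COV]: $\delta_{(i,j)}\in\{0,1\}$ for $(i,j)\in\mathrm{inc}(P)$, subject to (C2) $\delta_{(x_1,y_1)}+\delta_{(x_2,y_2)}\ge1$ for all $x_1,y_1,x_2,y_2\in V$ with $x_1\ne y_1$, $x_2\ne y_2$, $(x_2,y_1),(x_1,y_2)\in P$; and (C3) $\delta_{(x_1,y_1)}+\delta_{(x_2,y_2)}+\delta_{(x_3,y_3)}\ge1$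 for all $x_1,\dots,y_3\in V$ with $x_i\ne y_i$, $(x_2,y_1),(x_3,y_2),(x_1,y_3)\in P$. A feasible $0/1$ solution $\delta^*$ of [COV] is minimal if for every $(i,j)\in\mathrm{inc}(P)$ with $\delta^*_{(i,j)}=1$, changing it to $0$ yields an infeasible solution of [COV]. A triple $(a,c,b)$ of distinct elements of $V$ is a basic triple (of $\delta^*$) if $\delta^*_{(a,c)}=\delta^*_{(c,b)}=\delta^*_{(a,b)}=\delta^*_{(b,a)}=1$ and $\delta^*_{(c,a)}=\delta^*_{(b,c)}=0$; $T$ is the set of all basic triples. -}

module Defs where

open import Data.Nat using (ℕ)
open import Data.Fin using (Fin; _≟_)
open import Data.Bool using (Bool; true; false; _∧_; not; if_then_else_)
open import Data.Product using (_×_)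
open import Data.Sum using (_⊎_)
open import Relation.Nullary using (¬_)
open import Relation.Nullary.Decidable using (⌊_⌋)
open import Relation.Binary.PropositionalEquality using (_≡_; _≢_)

-- The ground set V is Fin n.  A relation (e.g. the partial order P) is a
-- Boolean-valued function: (x , y) ∈ P  iff  P x y ≡ true.
Rel₂ : ℕ → Set
Rel₂ n = Fin n → Fin n → Bool

-- A 0/1 vector indexed by ordered pairs: δ i j ∈ {false = 0, true = 1}.
-- Diagonal entries δ i i are never used.
Vect : ℕ → Set
Vect n = Fin n → Fin n → Bool

module _ {n : ℕ} (P : Rel₂ n) where

  Inc : Fin n → Fin n → Set
  Inc i j = (P i j ≡ false) × (P j i ≡ false)

  Convention : Vect n → Set
  Convention δ = ∀ i j → i ≢ j →
    (P i j ≡ true → δ i j ≡ true) × (P j i ≡ true → δ i j ≡ false)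

  C2 : Vect n → Set
  C2 δ = ∀ x₁ y₁ x₂ y₂ → x₁ ≢ y₁ → x₂ ≢ y₂ →
    P x₂ y₁ ≡ true → P x₁ y₂ ≡ true →
    (δ x₁ y₁ ≡ true) ⊎ (δ x₂ y₂ ≡ true)

  C3 : Vect n → Set
  C3 δ = ∀ x₁ y₁ x₂ y₂ x₃ y₃ → x₁ ≢ y₁ → x₂ ≢ y₂ → x₃ ≢ y₃ →
    P x₂ y₁ ≡ true → P x₃ y₂ ≡ true → P x₁ y₃ ≡ true →
    (δ x₁ y₁ ≡ true) ⊎ ((δ x₂ y₂ ≡ true) ⊎ (δ x₃ y₃ ≡ true))

  Feasible : Vect n → Set
  Feasible δ = Convention δ × C2 δ × C3 δ

update : {n : ℕ} → Vect n → Fin n → Fin n → Bool → Vect n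
update δ i j b x y = if ⌊ x ≟ i ⌋ ∧ ⌊ y ≟ j ⌋ then b else δ x y

Minimal : {n : ℕ} → Rel₂ n → Vect n → Set
Minimal P δ = Feasible P δ ×
  (∀ i j → Inc P i j → δ i j ≡ true → ¬ Feasible P (update δ i j false))

_≠ᵇ_ : {n : ℕ} → Fin n → Fin n → Bool
a ≠ᵇ b = not ⌊ a ≟ b ⌋

isBasic : {n : ℕ} → Vect n → Fin n → Fin n → Fin n → Bool
isBasic δ a c b =
  (a ≠ᵇ c) ∧ (a ≠ᵇ b) ∧ (c ≠ᵇ b) ∧
  δ a c ∧ δ c b ∧ δ a b ∧ δ b a ∧ not (δ c a) ∧ not (δ b c)

Sset : {n : ℕ} → Vect n → Fin n → Rel₂ n
Sset δ v i j = isBasic δ v i j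

Mset : {n : ℕ} → Vect n → Fin n → Rel₂ n
Mset δ v i j = isBasic δ j v i

Eset : {n : ℕ} → Vect n → Fin n → Rel₂ n
Eset δ v i j = isBasic δ i j v

-- δ^X built from δ, X and M = M_v:
--  (2) δ^X(i,j) = 0 and δ^X(j,i) = 1 for (i,j) ∈ X;
--  (1) δ^X(i,j) = 0 for (i,j) ∈ M;
--  (3) δ^X(i,j) = δ(i,j) otherwise.
-- (For X ∈ {S_v, E_v} these prescriptions never conflict, so the order of
-- the tests is immaterial.)
deltaX : {n : ℕ} → Vect n → Rel₂ n → Rel₂ n → Vect n
deltaX δ X M i j =
  if X i j then false
  else if X j i then true
  else if M i j then false
  else δ i j

-- Read δ i j = 0 as "i may not precede j", so δ j i = 0 forces i before j
-- (written i ≺ j below).  Feasibility makes ≺ asymmetric and free of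
-- 3-cycles, so i ≺ c ≺ j implies i ≺ j unless (i , c , j) is a basic triple;
-- minimality makes ≺ monotone along P, since an entry δ b a = 1 with
-- y ≤ b, a ≤ x and δ y x = 0 could be cleared without losing feasibility.
-- Each new zero of δ^X then crosses the cut {z | v ≺ z} (for X = S_v) or
-- {z | ¬ z ≺ v} (for X = E_v), whereas along every other zero of δ^X that
-- set is closed backwards; a violated cycle constraint of δ^X would hence
-- consist of old zeros only, contradicting the feasibility of δ.
module Submission where

open import Defs
open import Data.Nat using (ℕ)
open import Data.Fin using (Fin; _≟_)
open import Data.Bool using (Bool; true; false; _∧_; not; if_then_else_)
open import Data.Bool.Properties using (not-¬; ¬-not; not-injective)
open import Data.Product using (_×_; _,_; proj₁; proj₂; Σ-syntax)
open import Data.Sum using (_⊎_; inj₁; inj₂)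
open import Data.Empty using (⊥; ⊥-elim)
open import Relation.Nullary using (¬_; yes; no)
open import Relation.Binary.PropositionalEquality using (_≡_; _≢_; refl; sym; trans; cong; ≢-sym)
open import Relation.Binary.Structures using (IsPartialOrder)

private variable
  b₁ b₂ b₃ : Bool

some-true₂ : (b₁ ≡ false → b₂ ≡ false → ⊥) → b₁ ≡ true ⊎ b₂ ≡ true
some-true₂ {true}  _ = inj₁ refl
some-true₂ {false} {true} _ = inj₂ refl
some-true₂ {false} {false} refute = ⊥-elim (refute refl refl)

some-true₃ : (b₁ ≡ false → b₂ ≡ false → b₃ ≡ false → ⊥) →
  b₁ ≡ true ⊎ b₂ ≡ true ⊎ b₃ ≡ true
some-true₃ {true} _ = inj₁ refl
some-true₃ {false} refute = inj₂ (some-true₂ (refute refl))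

none-true₂ : b₁ ≡ true ⊎ b₂ ≡ true → b₁ ≡ false → b₂ ≡ false → ⊥
none-true₂ (inj₁ t) f _ = not-¬ t f
none-true₂ (inj₂ t) _ f = not-¬ t f

none-true₃ : b₁ ≡ true ⊎ b₂ ≡ true ⊎ b₃ ≡ true →
  b₁ ≡ false → b₂ ≡ false → b₃ ≡ false → ⊥
none-true₃ (inj₁ t) f _ _ = not-¬ t f
none-true₃ (inj₂ t) _ f₂ f₃ = none-true₂ t f₂ f₃

∧-elim : b₁ ∧ b₂ ≡ true → b₁ ≡ true × b₂ ≡ true
∧-elim {true} {true} refl = refl , refl

∧-intro : b₁ ≡ true → b₂ ≡ true → b₁ ∧ b₂ ≡ true
∧-intro refl refl = refl

≠ᵇ-elim : ∀ {n} {a b : Fin n} → a ≠ᵇ b ≡ true → a ≢ b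
≠ᵇ-elim {a = a} {b} e with a ≟ b
... | yes _ = λ _ → not-¬ e refl
... | no a≢b = a≢b

≠ᵇ-intro : ∀ {n} {a b : Fin n} → a ≢ b → a ≠ᵇ b ≡ true
≠ᵇ-intro {a = a} {b} a≢b with a ≟ b
... | yes a≡b = ⊥-elim (a≢b a≡b)
... | no _ = refl

record Basic {n : ℕ} (δ : Vect n) (a c b : Fin n) : Set where
  field
    a≢c : a ≢ c
    a≢b : a ≢ b
    c≢b : c ≢ b
    δac≡1 : δ a c ≡ true
    δcb≡1 : δ c b ≡ true
    δab≡1 : δ a b ≡ true
    δba≡1 : δ b a ≡ true
    δca≡0 : δ c a ≡ false
    δbc≡0 : δ b c ≡ false

isBasic⇒Basic : ∀ {n} (δ : Vect n) a c b → isBasic δ a c b ≡ true → Basic δ a c b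
isBasic⇒Basic δ a c b t =
  let (ac , t₁) = ∧-elim t
      (ab , t₂) = ∧-elim t₁
      (cb , t₃) = ∧-elim t₂
      (δac , t₄) = ∧-elim t₃
      (δcb , t₅) = ∧-elim t₄
      (δab , t₆) = ∧-elim t₅
      (δba , t₇) = ∧-elim t₆
      (δca , δbc) = ∧-elim t₇
  in record
    { a≢c = ≠ᵇ-elim ac ; a≢b = ≠ᵇ-elim ab ; c≢b = ≠ᵇ-elim cb
    ; δac≡1 = δac ; δcb≡1 = δcb ; δab≡1 = δab ; δba≡1 = δba
    ; δca≡0 = not-injective δca ; δbc≡0 = not-injective δbc }

Basic⇒isBasic : ∀ {n} {δ : Vect n} {a c b} → Basic δ a c b → isBasic δ a c b ≡ true
Basic⇒isBasic basic =
  ∧-intro (≠ᵇ-intro a≢c) (∧-intro (≠ᵇ-intro a≢b) (∧-intro (≠ᵇ-intro c≢b)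
    (∧-intro δac≡1 (∧-intro δcb≡1 (∧-intro δab≡1 (∧-intro δba≡1
      (∧-intro (cong not δca≡0) (cong not δbc≡0))))))))
  where open Basic basic

update-entry : ∀ {n} (δ : Vect n) i j b x y →
  (x ≡ i × y ≡ j × update δ i j b x y ≡ b) ⊎ update δ i j b x y ≡ δ x y
update-entry δ i j b x y with x ≟ i | y ≟ j
... | yes x≡i | yes y≡j = inj₁ (x≡i , y≡j , refl)
... | yes _ | no _ = inj₂ refl
... | no _ | _ = inj₂ refl

data DeltaXEntry {n} (δ : Vect n) (X M : Rel₂ n) (i j : Fin n) : Bool → Set where
  removed   : X i j ≡ true → DeltaXEntry δ X M i j false
  reversed  : X j i ≡ true → DeltaXEntry δ X M i j true
  cleared   : M i j ≡ true → DeltaXEntry δ X M i j false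
  unchanged : X j i ≡ false → DeltaXEntry δ X M i j (δ i j)

deltaX-entry : ∀ {n} (δ : Vect n) X M i j → DeltaXEntry δ X M i j (deltaX δ X M i j)
deltaX-entry δ X M i j = entry
  where
  -- stated with deltaX unfolded, so that the with-abstraction below can see X i j
  entry : DeltaXEntry δ X M i j
    (if X i j then false else if X j i then true else if M i j then false else δ i j)
  entry with X i j in xij | X j i in xji | M i j in mij
  ... | true  | _     | _     = removed xij
  ... | false | true  | _     = reversed xji
  ... | false | false | true  = cleared mij
  ... | false | false | false = unchanged xji

module _ {n : ℕ} {P : Rel₂ n} (po : IsPartialOrder _≡_ (λ x y → P x y ≡ true)) where

  open IsPartialOrder po using () renaming (refl to ≤-refl; trans to ≤-trans)

  private
    _≤_ : Fin n → Fin n → Set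
    x ≤ y = P x y ≡ true

  Dominates : Vect n → Vect n → Set
  Dominates δ δ′ = ∀ p q → p ≢ q → δ′ p q ≡ false →
    Σ[ p′ ∈ Fin n ] Σ[ q′ ∈ Fin n ] p′ ≢ q′ × δ p′ q′ ≡ false × p′ ≤ p × q ≤ q′

  dominated-C2 : ∀ {δ δ′} → C2 P δ → Dominates δ δ′ → C2 P δ′
  dominated-C2 c2 dom x₁ y₁ x₂ y₂ x₁≢y₁ x₂≢y₂ x₂≤y₁ x₁≤y₂ = some-true₂ λ z₁ z₂ →
    let (p₁ , q₁ , p₁≢q₁ , z₁′ , p₁≤x₁ , y₁≤q₁) = dom x₁ y₁ x₁≢y₁ z₁
        (p₂ , q₂ , p₂≢q₂ , z₂′ , p₂≤x₂ , y₂≤q₂) = dom x₂ y₂ x₂≢y₂ z₂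
    in none-true₂ (c2 p₁ q₁ p₂ q₂ p₁≢q₁ p₂≢q₂
         (≤-trans p₂≤x₂ (≤-trans x₂≤y₁ y₁≤q₁)) (≤-trans p₁≤x₁ (≤-trans x₁≤y₂ y₂≤q₂)))
       z₁′ z₂′

  dominated-C3 : ∀ {δ δ′} → C3 P δ → Dominates δ δ′ → C3 P δ′
  dominated-C3 c3 dom x₁ y₁ x₂ y₂ x₃ y₃ x₁≢y₁ x₂≢y₂ x₃≢y₃ x₂≤y₁ x₃≤y₂ x₁≤y₃ =
    some-true₃ λ z₁ z₂ z₃ →
    let (p₁ , q₁ , p₁≢q₁ , z₁′ , p₁≤x₁ , y₁≤q₁) = dom x₁ y₁ x₁≢y₁ z₁
        (p₂ , q₂ , p₂≢q₂ , z₂′ , p₂≤x₂ , y₂≤q₂) = dom x₂ y₂ x₂≢y₂ z₂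
        (p₃ , q₃ , p₃≢q₃ , z₃′ , p₃≤x₃ , y₃≤q₃) = dom x₃ y₃ x₃≢y₃ z₃
    in none-true₃ (c3 p₁ q₁ p₂ q₂ p₃ q₃ p₁≢q₁ p₂≢q₂ p₃≢q₃
         (≤-trans p₂≤x₂ (≤-trans x₂≤y₁ y₁≤q₁)) (≤-trans p₃≤x₃ (≤-trans x₃≤y₂ y₂≤q₂))
         (≤-trans p₁≤x₁ (≤-trans x₁≤y₃ y₃≤q₃)))
       z₁′ z₂′ z₃′

  clear-dominated-feasible : ∀ {δ i j p q} → Feasible P δ → Inc P i j →
    p ≢ q → δ p q ≡ false → p ≤ i → j ≤ q → Feasible P (update δ i j false)
  clear-dominated-feasible {δ} {i} {j} {p} {q} (conv , c2 , c3) (i≰j , _) p≢q δpq≡0 p≤i j≤q =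
    convention , dominated-C2 c2 dom , dominated-C3 c3 dom
    where
    dom : Dominates δ (update δ i j false)
    dom x y x≢y z with update-entry δ i j false x y
    ... | inj₁ (refl , refl , _) = p , q , p≢q , δpq≡0 , p≤i , j≤q
    ... | inj₂ eq = x , y , x≢y , trans (sym eq) z , ≤-refl , ≤-refl

    convention : Convention P (update δ i j false)
    convention x y x≢y with update-entry δ i j false x y
    ... | inj₁ (refl , refl , eq) = (λ i≤j → ⊥-elim (not-¬ i≤j i≰j)) , λ _ → eq
    ... | inj₂ eq =
      (λ x≤y → trans eq (proj₁ (conv x y x≢y) x≤y)) , λ y≤x → trans eq (proj₂ (conv x y x≢y) y≤x)

  module FeasibleSolution (δ : Vect n) (feasible : Feasible P δ) where

    private
      conv = proj₁ feasible
      c2 = proj₁ (proj₂ feasible)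
      c3 = proj₂ (proj₂ feasible)

    _≺_ : Fin n → Fin n → Set
    a ≺ b = a ≢ b × δ b a ≡ false

    ≤⇒one : ∀ {i j} → i ≢ j → i ≤ j → δ i j ≡ true
    ≤⇒one {i} {j} i≢j = proj₁ (conv i j i≢j)

    ≥⇒zero : ∀ {i j} → i ≢ j → j ≤ i → δ i j ≡ false
    ≥⇒zero {i} {j} i≢j = proj₂ (conv i j i≢j)

    one⇒¬≺ : ∀ {a b} → δ b a ≡ true → ¬ a ≺ b
    one⇒¬≺ δba≡1 (_ , δba≡0) = not-¬ δba≡1 δba≡0

    ≺⇒≱ : ∀ {a b} → a ≺ b → ¬ b ≤ a
    ≺⇒≱ (a≢b , δba≡0) b≤a = not-¬ (≤⇒one (≢-sym a≢b) b≤a) δba≡0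

    ≺-asym : ∀ {a b} → a ≺ b → ¬ b ≺ a
    ≺-asym {a} {b} (a≢b , δba≡0) (_ , δab≡0) =
      none-true₂ (c2 a b b a a≢b (≢-sym a≢b) ≤-refl ≤-refl) δab≡0 δba≡0

    ≺⇒one : ∀ {a b} → a ≺ b → δ a b ≡ true
    ≺⇒one a≺b@(a≢b , _) = ¬-not λ δab≡0 → ≺-asym a≺b (≢-sym a≢b , δab≡0)

    ≺-acyclic₃ : ∀ {a b c} → a ≺ b → b ≺ c → ¬ c ≺ a
    ≺-acyclic₃ {a} {b} {c} (a≢b , δba≡0) (b≢c , δcb≡0) (c≢a , δac≡0) =
      none-true₃ (c3 b a a c c b (≢-sym a≢b) (≢-sym c≢a) (≢-sym b≢c) ≤-refl ≤-refl ≤-refl)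
        δba≡0 δac≡0 δcb≡0

    ≺-trans : ∀ {a c b} → a ≺ c → c ≺ b → isBasic δ a c b ≡ false → a ≺ b
    ≺-trans {a} {c} {b} a≺c c≺b not-basic = a≢b , δba≡0
      where
      a≢b : a ≢ b
      a≢b refl = ≺-asym a≺c c≺b

      δab≡1 : δ a b ≡ true
      δab≡1 = ¬-not λ δab≡0 → ≺-acyclic₃ a≺c c≺b (≢-sym a≢b , δab≡0)

      basic : δ b a ≡ true → Basic δ a c b
      basic δba≡1 = record
        { a≢c = proj₁ a≺c ; a≢b = a≢b ; c≢b = proj₁ c≺b
        ; δac≡1 = ≺⇒one a≺c ; δcb≡1 = ≺⇒one c≺b ; δab≡1 = δab≡1 ; δba≡1 = δba≡1
        ; δca≡0 = proj₂ a≺c ; δbc≡0 = proj₂ c≺b }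

      δba≡0 : δ b a ≡ false
      δba≡0 = ¬-not λ δba≡1 → not-¬ (Basic⇒isBasic (basic δba≡1)) not-basic

    module _ (G : Fin n → Set) (G-mono : ∀ {x y} → x ≤ y → G x → G y) where

      data ZeroAt (x y : Fin n) : Set where
        inherited : δ x y ≡ false → (G y → G x) → ZeroAt x y
        across    : G x → ¬ G y → ZeroAt x y

      back : ∀ {x y} → ZeroAt x y → G y → G x
      back (inherited _ reflect) = reflect
      back (across gx _) _ = gx

      module _ {δ′ : Vect n} (zero-at : ∀ {x y} → x ≢ y → δ′ x y ≡ false → ZeroAt x y) where

        cut-C2 : C2 P δ′
        cut-C2 x₁ y₁ x₂ y₂ x₁≢y₁ x₂≢y₂ x₂≤y₁ x₁≤y₂ = some-true₂ λ z₁ z₂ →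
          refute (zero-at x₁≢y₁ z₁) (zero-at x₂≢y₂ z₂)
          where
          refute : ZeroAt x₁ y₁ → ZeroAt x₂ y₂ → ⊥
          refute (across g ¬g) z₂ = ¬g (G-mono x₂≤y₁ (back z₂ (G-mono x₁≤y₂ g)))
          refute z₁ (across g ¬g) = ¬g (G-mono x₁≤y₂ (back z₁ (G-mono x₂≤y₁ g)))
          refute (inherited z₁ _) (inherited z₂ _) =
            none-true₂ (c2 x₁ y₁ x₂ y₂ x₁≢y₁ x₂≢y₂ x₂≤y₁ x₁≤y₂) z₁ z₂

        cut-C3 : C3 P δ′
        cut-C3 x₁ y₁ x₂ y₂ x₃ y₃ x₁≢y₁ x₂≢y₂ x₃≢y₃ x₂≤y₁ x₃≤y₂ x₁≤y₃ = some-true₃ λ z₁ z₂ z₃ →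
          refute (zero-at x₁≢y₁ z₁) (zero-at x₂≢y₂ z₂) (zero-at x₃≢y₃ z₃)
          where
          refute : ZeroAt x₁ y₁ → ZeroAt x₂ y₂ → ZeroAt x₃ y₃ → ⊥
          refute (across g ¬g) z₂ z₃ =
            ¬g (G-mono x₂≤y₁ (back z₂ (G-mono x₃≤y₂ (back z₃ (G-mono x₁≤y₃ g)))))
          refute z₁ (across g ¬g) z₃ =
            ¬g (G-mono x₃≤y₂ (back z₃ (G-mono x₁≤y₃ (back z₁ (G-mono x₂≤y₁ g)))))
          refute z₁ z₂ (across g ¬g) =
            ¬g (G-mono x₁≤y₃ (back z₁ (G-mono x₂≤y₁ (back z₂ (G-mono x₃≤y₂ g)))))
          refute (inherited z₁ _) (inherited z₂ _) (inherited z₃ _) =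
            none-true₃ (c3 x₁ y₁ x₂ y₂ x₃ y₃ x₁≢y₁ x₂≢y₂ x₃≢y₃ x₂≤y₁ x₃≤y₂ x₁≤y₃) z₁ z₂ z₃

        cut-≤⇒one : ∀ {i j} → i ≢ j → i ≤ j → δ′ i j ≡ true
        cut-≤⇒one i≢j i≤j = ¬-not λ z → refute (zero-at i≢j z)
          where
          refute : ZeroAt _ _ → ⊥
          refute (inherited z _) = not-¬ (≤⇒one i≢j i≤j) z
          refute (across g ¬g) = ¬g (G-mono i≤j g)

      deltaX-feasible : (X M : Rel₂ n) →
        (∀ {x y} → X x y ≡ true → G x × ¬ G y) →
        (∀ {x y} → M x y ≡ true → G x × ¬ G y) →
        (∀ {x y} → y ≺ x → X y x ≡ false → G y → G x) →
        Feasible P (deltaX δ X M)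
      deltaX-feasible X M X-across M-across reflect =
        (λ i j i≢j → cut-≤⇒one zero-at i≢j , ≥⇒zero-deltaX i≢j) , cut-C2 zero-at , cut-C3 zero-at
        where
        zero-at : ∀ {x y} → x ≢ y → deltaX δ X M x y ≡ false → ZeroAt x y
        zero-at {x} {y} x≢y z with deltaX δ X M x y | deltaX-entry δ X M x y
        ... | _ | removed t = across (proj₁ (X-across t)) (proj₂ (X-across t))
        ... | _ | reversed _ = ⊥-elim (not-¬ refl z)
        ... | _ | cleared t = across (proj₁ (M-across t)) (proj₂ (M-across t))
        ... | _ | unchanged Xyx≡0 = inherited z (reflect (≢-sym x≢y , z) Xyx≡0)

        ≥⇒zero-deltaX : ∀ {i j} → i ≢ j → j ≤ i → deltaX δ X M i j ≡ false
        ≥⇒zero-deltaX {i} {j} i≢j j≤i with deltaX δ X M i j | deltaX-entry δ X M i j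
        ... | _ | removed _ = refl
        ... | _ | reversed t = ⊥-elim (proj₂ (X-across t) (G-mono j≤i (proj₁ (X-across t))))
        ... | _ | cleared _ = refl
        ... | _ | unchanged _ = ≥⇒zero i≢j j≤i

  module MinimalSolution (δ : Vect n) (minimal : Minimal P δ) where

    open FeasibleSolution δ (proj₁ minimal)

    ≺-mono : ∀ {a x y b} → a ≤ x → x ≺ y → y ≤ b → a ≺ b
    ≺-mono {a} {x} {y} {b} a≤x x≺y@(x≢y , δyx≡0) y≤b = a≢b , ¬-not redundant
      where
      a≢b : a ≢ b
      a≢b refl = ≺⇒≱ x≺y (≤-trans y≤b a≤x)

      redundant : δ b a ≢ true
      redundant δba≡1 with P b a in b≤a | P a b in a≤b
      ... | true | _ = ≺⇒≱ x≺y (≤-trans y≤b (≤-trans b≤a a≤x))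
      ... | false | true = not-¬ δba≡1 (≥⇒zero (≢-sym a≢b) a≤b)
      ... | false | false = proj₂ minimal b a (b≤a , a≤b) δba≡1
            (clear-dominated-feasible (proj₁ minimal) (b≤a , a≤b) (≢-sym x≢y) δyx≡0 y≤b a≤x)

    S-feasible : ∀ v → Feasible P (deltaX δ (Sset δ v) (Mset δ v))
    S-feasible v =
      deltaX-feasible (v ≺_) (λ x≤y v≺x → ≺-mono ≤-refl v≺x x≤y)
        (Sset δ v) (Mset δ v) S-across M-across
        (λ y≺x not-basic v≺y → ≺-trans v≺y y≺x not-basic)
      where
      S-across : ∀ {x y} → Sset δ v x y ≡ true → v ≺ x × ¬ v ≺ y
      S-across {x} {y} t = let open Basic (isBasic⇒Basic δ v x y t) in
        (a≢c , δca≡0) , one⇒¬≺ δba≡1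

      M-across : ∀ {x y} → Mset δ v x y ≡ true → v ≺ x × ¬ v ≺ y
      M-across {x} {y} t = let open Basic (isBasic⇒Basic δ y v x t) in
        (c≢b , δbc≡0) , one⇒¬≺ δac≡1

    E-feasible : ∀ v → Feasible P (deltaX δ (Eset δ v) (Mset δ v))
    E-feasible v =
      deltaX-feasible (λ z → ¬ z ≺ v) (λ x≤y ¬x≺v y≺v → ¬x≺v (≺-mono x≤y y≺v ≤-refl))
        (Eset δ v) (Mset δ v) E-across M-across
        (λ y≺x not-basic ¬y≺v x≺v → ¬y≺v (≺-trans y≺x x≺v not-basic))
      where
      E-across : ∀ {x y} → Eset δ v x y ≡ true → ¬ x ≺ v × ¬ ¬ y ≺ v
      E-across {x} {y} t = let open Basic (isBasic⇒Basic δ x y v t) in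
        one⇒¬≺ δba≡1 , λ ¬y≺v → ¬y≺v (c≢b , δbc≡0)

      M-across : ∀ {x y} → Mset δ v x y ≡ true → ¬ x ≺ v × ¬ ¬ y ≺ v
      M-across {x} {y} t = let open Basic (isBasic⇒Basic δ y v x t) in
        one⇒¬≺ δcb≡1 , λ ¬y≺v → ¬y≺v (a≢c , δca≡0)

lemma3 : (n : ℕ) (P : Rel₂ n) →
    IsPartialOrder _≡_ (λ x y → P x y ≡ true) →
    (δ : Vect n) → Minimal P δ →
    (v : Fin n) →
    Feasible P (deltaX δ (Sset δ v) (Mset δ v))
    × Feasible P (deltaX δ (Eset δ v) (Mset δ v))
lemma3 n P po δ minimal v = S-feasible v , E-feasible v
  where open MinimalSolution po δ minimal
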